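{- Let $X$ be a connected bipartite graph that is edge-transitive. Then $X$ is a blow-up of a worthy graph; more precisely, there exist a connected, bipartite, edge-transitive, worthy graph $Y$ and positive integers $k,m$ such that $X$ is isomorphic to the $(k,m)$-blow-up of $Y$.
   Context: All graphs are simple and undirected. A graph is edge-transitive if its automorphism group acts transitively on its edge-set. A graph $X$ is worthy if no two distinct vertices of $X$ have the same neighbourhood; otherwise it is unworthy. For a bipartite graph $Y$ with parts $U$ and $W$ and positive integers $k,m$, the $(k,m)$-blow-up of $Y$ is the graph obtained by replacing each vertex $u\in U$ by $k$ new vertices $u_1,\dots,u_k$, each vertex $w\in W$ by $m$ new vertices $w_1,\dots,w_m$, and each edge $\{u,w\}$ with $u\in U$, $w\in W$ by the $km$ edges $\{u_i,w_j\}$ ($1\le i\le k$, $1\le j\le m$). -}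

module Defs where

open import Data.Nat using (ℕ; suc; _≤_; _<_)
open import Data.Fin using (Fin)
open import Data.Bool using (Bool; true; false; if_then_else_)
open import Data.Product using (Σ; ∃; _×_; _,_; proj₁)
open import Data.Sum using (_⊎_)
open import Relation.Binary.PropositionalEquality using (_≡_; _≢_)
open import Function.Bundles using (_↔_; Inverse)

record Graph : Set where
  field
    n      : ℕ
    adj    : Fin n → Fin n → Bool
    sym    : ∀ x y → adj x y ≡ adj y x
    irrefl : ∀ x → adj x x ≡ false
open Graph public

V : Graph → Set
V X = Fin (n X)

Edge : (X : Graph) → V X → V X → Set
Edge X x y = adj X x y ≡ true

record Automorphism (X : Graph) : Set where
  field
    perm     : V X ↔ V X
    preserve : ∀ x y → adj X (Inverse.to perm x) (Inverse.to perm y) ≡ adj X x y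
open Automorphism public

EdgeTransitive : Graph → Set
EdgeTransitive X = ∀ x y u v → Edge X x y → Edge X u v →
  Σ (Automorphism X) λ σ →
    let f = Inverse.to (perm σ) in
    (f x ≡ u × f y ≡ v) ⊎ (f x ≡ v × f y ≡ u)

data Walk (X : Graph) : V X → V X → Set where
  here : ∀ {x} → Walk X x x
  step : ∀ {x y z} → Edge X x y → Walk X y z → Walk X x z

Connected : Graph → Set
Connected X = ∀ x y → Walk X x y

-- A bipartition: a proper 2-colouring (colour false = part U, colour true = part W).
Bipartition : Graph → Set
Bipartition X = Σ (V X → Bool) λ c → ∀ x y → Edge X x y → c x ≢ c y

Bipartite : Graph → Set
Bipartite X = Bipartition X

Worthy : Graph → Set
Worthy X = ∀ x y → (∀ z → adj X x z ≡ adj X y z) → x ≡ y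

-- (k,m)-blow-up of Y w.r.t. a bipartition (U = colour false, W = colour true):
-- u ∈ U becomes k copies, w ∈ W becomes m copies; copies adjacent iff originals are.
BlowupV : (Y : Graph) → Bipartition Y → ℕ → ℕ → Set
BlowupV Y (c , _) k m = Σ (V Y) λ v → Fin (if c v then m else k)

BlowupAdj : (Y : Graph) (b : Bipartition Y) (k m : ℕ) →
  BlowupV Y b k m → BlowupV Y b k m → Bool
BlowupAdj Y b k m (v , _) (w , _) = adj Y v w

IsoToBlowup : (X Y : Graph) (b : Bipartition Y) (k m : ℕ) → Set
IsoToBlowup X Y b k m =
  Σ (V X ↔ BlowupV Y b k m) λ φ →
    ∀ x y → BlowupAdj Y b k m (Inverse.to φ x) (Inverse.to φ y) ≡ adj X x y

module Submission where

-- Identifying twins (vertices with the same neighbourhood) gives a worthy graph Y, represented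
-- on the least element of each twin class; Y inherits connectivity, the bipartition and
-- edge-transitivity because automorphisms permute twin classes, and X is the blow-up of Y
-- obtained by putting each twin class back. It remains to see that twin classes of the same
-- colour have equal size. Automorphisms preserve this size, so edge-transitivity forces every
-- edge to carry the two sizes found at a fixed reference edge, and walking from that edge the
-- colours decide which endpoint carries which size.

open import Defs hiding (sym; n)
open import Data.Nat using (ℕ; zero; suc; _+_; _≤_; s≤s; z≤n; >-nonZero⁻¹)
open import Data.Fin using (Fin; zero; suc; _<_)
open import Data.Fin.Properties using (nonZeroIndex; any?; all?; _<?_; <-cmp; 0↔⊥; 1↔⊤; +↔⊎)
open import Data.Fin.Induction using (<-wellFounded)
open import Data.Fin.Permutation using (↔⇒≡)
open import Data.Bool using (Bool; true; false; T; not; if_then_else_)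
open import Data.Bool.Properties using (T-irrelevant; ¬-not) renaming (_≟_ to _≟ᵇ_)
open import Data.Product using (Σ; ∃; _×_; _,_; proj₁; proj₂)
open import Data.Product.Function.Dependent.Propositional using (Σ-↔)
open import Data.Sum using (_⊎_; inj₁; inj₂)
open import Data.Sum.Function.Propositional using (_⊎-↔_)
open import Data.Empty using (⊥-elim)
open import Function using (_∘_)
open import Function.Bundles using (_↔_; Inverse; mk↔ₛ′)
open import Function.Properties.Inverse using (↔-refl; ↔-sym; ↔-trans)
open import Induction.WellFounded using (Acc; acc)
open import Relation.Binary.Core using (Rel)
open import Relation.Binary.Structures using (IsDecEquivalence)
open import Relation.Binary.Definitions using (tri<; tri≈; tri>)
open import Relation.Nullary using (¬_; Dec; yes; no; does)
open import Relation.Nullary.Decidable using (⌊_⌋; ¬?; _×-dec_; toWitness; fromWitness; dec-true; dec-false)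
open import Relation.Binary.PropositionalEquality
  using (_≡_; _≢_; refl; sym; trans; cong; cong₂; subst; subst₂; ≢-sym; module ≡-Reasoning)

open Inverse using (to; from; strictlyInverseˡ; strictlyInverseʳ)

_≐_ : {A : Set} → A × A → A × A → Set
(x , y) ≐ (u , v) = (x ≡ u × y ≡ v) ⊎ (x ≡ v × y ≡ u)

module _ {A : Set} where

  ≐-sym : {p q : A × A} → p ≐ q → q ≐ p
  ≐-sym (inj₁ (x≡u , y≡v)) = inj₁ (sym x≡u , sym y≡v)
  ≐-sym (inj₂ (x≡v , y≡u)) = inj₂ (sym y≡u , sym x≡v)

  ≐-trans : {p q r : A × A} → p ≐ q → q ≐ r → p ≐ r
  ≐-trans (inj₁ (a , b)) (inj₁ (c , d)) = inj₁ (trans a c , trans b d)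
  ≐-trans (inj₁ (a , b)) (inj₂ (c , d)) = inj₂ (trans a c , trans b d)
  ≐-trans (inj₂ (a , b)) (inj₁ (c , d)) = inj₂ (trans a d , trans b c)
  ≐-trans (inj₂ (a , b)) (inj₂ (c , d)) = inj₁ (trans a d , trans b c)

  ≐-map : {B : Set} (f : A → B) {x y u v : A} → (x , y) ≐ (u , v) → (f x , f y) ≐ (f u , f v)
  ≐-map f (inj₁ (x≡u , y≡v)) = inj₁ (cong f x≡u , cong f y≡v)
  ≐-map f (inj₂ (x≡v , y≡u)) = inj₂ (cong f x≡v , cong f y≡u)

  ≐-cancelˡ : {x y u v : A} → x ≡ u → (x , y) ≐ (u , v) → y ≡ v
  ≐-cancelˡ _   (inj₁ (_ , y≡v))     = y≡v
  ≐-cancelˡ x≡u (inj₂ (x≡v , y≡u)) = trans y≡u (trans (sym x≡u) x≡v)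

≢⇒≐ : {a b c d : Bool} → a ≢ b → c ≢ d → (a , b) ≐ (c , d)
≢⇒≐ {a} {c = c} a≢b c≢d
  rewrite ¬-not (≢-sym a≢b) | ¬-not (≢-sym c≢d) = complementary a c
  where
  complementary : ∀ a c → (a , not a) ≐ (c , not c)
  complementary false false = inj₁ (refl , refl)
  complementary false true  = inj₂ (refl , refl)
  complementary true  false = inj₂ (refl , refl)
  complementary true  true  = inj₁ (refl , refl)

Sub : ∀ {k} → (Fin k → Bool) → Set
Sub {k} P = Σ (Fin k) (T ∘ P)

Sub-≡ : ∀ {k} {P : Fin k → Bool} {a b : Sub P} → proj₁ a ≡ proj₁ b → a ≡ b
Sub-≡ {a = x , p} {b = .x , q} refl = cong (x ,_) (T-irrelevant p q)

count : ∀ {k} → (Fin k → Bool) → ℕ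
count {zero}  P = 0
count {suc k} P = (if P zero then 1 else 0) + count (P ∘ suc)

T↔Fin : ∀ b → T b ↔ Fin (if b then 1 else 0)
T↔Fin false = ↔-sym 0↔⊥
T↔Fin true  = ↔-sym 1↔⊤

Sub-suc↔ : ∀ {k} (P : Fin (suc k) → Bool) → Sub P ↔ (T (P zero) ⊎ Sub (P ∘ suc))
Sub-suc↔ P = mk↔ₛ′ split join split-join join-split
  where
  split : Sub P → T (P zero) ⊎ Sub (P ∘ suc)
  split (zero  , p) = inj₁ p
  split (suc x , p) = inj₂ (x , p)
  join : T (P zero) ⊎ Sub (P ∘ suc) → Sub P
  join (inj₁ p)       = zero , p
  join (inj₂ (x , p)) = suc x , p
  split-join : ∀ s → split (join s) ≡ s
  split-join (inj₁ _) = refl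
  split-join (inj₂ _) = refl
  join-split : ∀ s → join (split s) ≡ s
  join-split (zero  , _) = refl
  join-split (suc _ , _) = refl

Sub↔Fin : ∀ {k} (P : Fin k → Bool) → Sub P ↔ Fin (count P)
Sub↔Fin {zero}  P = mk↔ₛ′ (λ ()) (λ ()) (λ ()) (λ ())
Sub↔Fin {suc k} P =
  ↔-trans (Sub-suc↔ P) (↔-trans (T↔Fin (P zero) ⊎-↔ Sub↔Fin (P ∘ suc)) (↔-sym +↔⊎))

module Representatives {N ℓ} {_∼_ : Rel (Fin N) ℓ} (isDecEquivalence : IsDecEquivalence _∼_) where

  open IsDecEquivalence isDecEquivalence
    using () renaming (refl to ∼-refl; sym to ∼-sym; trans to ∼-trans; _≟_ to _∼?_)

  smaller? : ∀ x → Dec (∃ λ y → y < x × x ∼ y)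
  smaller? x = any? λ y → y <? x ×-dec x ∼? y

  isLeast : Fin N → Bool
  isLeast x = ⌊ ¬? (smaller? x) ⌋

  least-minimal : ∀ {r y} → T (isLeast r) → y < r → ¬ r ∼ y
  least-minimal l y<r r∼y = toWitness l (_ , y<r , r∼y)

  least-unique : ∀ {r r′} → T (isLeast r) → T (isLeast r′) → r ∼ r′ → r ≡ r′
  least-unique {r} {r′} l l′ r∼r′ with <-cmp r r′
  ... | tri< r<r′ _ _ = ⊥-elim (least-minimal l′ r<r′ (∼-sym r∼r′))
  ... | tri≈ _ r≡r′ _ = r≡r′
  ... | tri> _ _ r′<r = ⊥-elim (least-minimal l r′<r r∼r′)

  Representative : Set
  Representative = Sub isLeast

  representative : ∀ x → Σ Representative λ r → x ∼ proj₁ r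
  representative x = descend x (<-wellFounded x)
    where
    descend : ∀ x → Acc _<_ x → Σ Representative λ r → x ∼ proj₁ r
    descend x (acc rs) with smaller? x
    ... | no none = (x , fromWitness none) , ∼-refl
    ... | yes (y , y<x , x∼y) with descend y (rs y<x)
    ...   | r , y∼r = r , ∼-trans x∼y y∼r

  representative-unique : ∀ x (r : Representative) → x ∼ proj₁ r → proj₁ (representative x) ≡ r
  representative-unique x (r , l) x∼r with representative x
  ... | (r′ , l′) , x∼r′ = Sub-≡ (least-unique l′ l (∼-trans (∼-sym x∼r′) x∼r))

  #classes : ℕ
  #classes = count isLeast

  enumeration : Representative ↔ Fin #classes
  enumeration = Sub↔Fin isLeast

  ι : Fin #classes → Fin N
  ι i = proj₁ (from enumeration i)

  [_] : Fin N → Fin #classes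
  [ x ] = to enumeration (proj₁ (representative x))

  ∼ι[] : ∀ x → x ∼ ι [ x ]
  ∼ι[] x = subst (x ∼_) (sym (cong proj₁ (strictlyInverseʳ enumeration (proj₁ (representative x)))))
                 (proj₂ (representative x))

  []-resp : ∀ {x y} → x ∼ y → [ x ] ≡ [ y ]
  []-resp {x} {y} x∼y =
    cong (to enumeration) (sym (representative-unique y _ (∼-trans (∼-sym x∼y) (proj₂ (representative x)))))

  [ι] : ∀ i → [ ι i ] ≡ i
  [ι] i = trans (cong (to enumeration) (representative-unique (ι i) (from enumeration i) ∼-refl))
                (strictlyInverseˡ enumeration i)

  Class : Fin N → Set
  Class x = Sub (λ y → ⌊ x ∼? y ⌋)

  classSize : Fin N → ℕ
  classSize x = count (λ y → ⌊ x ∼? y ⌋)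

  classSize-pos : ∀ x → 1 ≤ classSize x
  classSize-pos x = >-nonZero⁻¹ _ {{nonZeroIndex (to (Sub↔Fin _) (x , fromWitness {a? = x ∼? x} ∼-refl))}}

  Fin↔Σ-classes : Fin N ↔ Σ (Fin #classes) (Class ∘ ι)
  Fin↔Σ-classes = mk↔ₛ′ classify unclassify classify-unclassify (λ _ → refl)
    where
    classify : Fin N → Σ (Fin #classes) (Class ∘ ι)
    classify x = [ x ] , x , fromWitness (∼-sym (∼ι[] x))
    unclassify : Σ (Fin #classes) (Class ∘ ι) → Fin N
    unclassify (_ , x , _) = x
    same-class : ∀ {i j x} {p q} → i ≡ j → _≡_ {A = Σ (Fin #classes) (Class ∘ ι)} (i , x , p) (j , x , q)
    same-class refl = cong (_ ,_) (Sub-≡ refl)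
    classify-unclassify : ∀ c → classify (unclassify c) ≡ c
    classify-unclassify (i , x , p) = same-class (trans ([]-resp (∼-sym (toWitness p))) ([ι] i))

  classSize-invariant : (π : Fin N ↔ Fin N) →
    (∀ {x y} → x ∼ y → to π x ∼ to π y) → (∀ {x y} → x ∼ y → from π x ∼ from π y) →
    ∀ x → classSize (to π x) ≡ classSize x
  classSize-invariant π to-resp from-resp x =
    sym (↔⇒≡ (↔-trans (↔-sym (Sub↔Fin _)) (↔-trans image (Sub↔Fin _))))
    where
    image : Class x ↔ Class (to π x)
    image = mk↔ₛ′
      (λ (y , p) → to π y , fromWitness (to-resp (toWitness p)))
      (λ (y , p) → from π y ,
        fromWitness (subst (_∼ from π y) (strictlyInverseʳ π x) (from-resp (toWitness p))))
      (λ (y , _) → Sub-≡ (strictlyInverseˡ π y))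
      (λ (y , _) → Sub-≡ (strictlyInverseʳ π y))

Twins : (X : Graph) → Rel (V X) _
Twins X x y = ∀ z → adj X x z ≡ adj X y z

twins-isDecEquivalence : (X : Graph) → IsDecEquivalence (Twins X)
twins-isDecEquivalence X = record
  { isEquivalence = record
    { refl  = λ _ → refl
    ; sym   = λ t z → sym (t z)
    ; trans = λ t u z → trans (t z) (u z)
    }
  ; _≟_ = λ x y → all? λ z → adj X x z ≟ᵇ adj X y z
  }

module _ (X : Graph) where

  twins-adj : ∀ {x x′ y y′} → Twins X x x′ → Twins X y y′ → adj X x y ≡ adj X x′ y′
  twins-adj {x} {x′} {y} {y′} x≈x′ y≈y′ = begin
    adj X x y    ≡⟨ x≈x′ y ⟩
    adj X x′ y   ≡⟨ Graph.sym X x′ y ⟩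
    adj X y x′   ≡⟨ y≈y′ x′ ⟩
    adj X y′ x′  ≡⟨ Graph.sym X y′ x′ ⟩
    adj X x′ y′  ∎
    where open ≡-Reasoning

module _ {X : Graph} where

  apply : Automorphism X → V X → V X
  apply σ = to (perm σ)

  _⁻¹ : Automorphism X → Automorphism X
  σ ⁻¹ = record
    { perm     = ↔-sym (perm σ)
    ; preserve = λ x y → trans (sym (preserve σ (from (perm σ) x) (from (perm σ) y)))
                               (cong₂ (adj X) (strictlyInverseˡ (perm σ) x) (strictlyInverseˡ (perm σ) y))
    }

  automorphism-twins : ∀ (σ : Automorphism X) {x y} → Twins X x y → Twins X (apply σ x) (apply σ y)
  automorphism-twins σ {x} {y} x≈y z = begin
    adj X (f x) z          ≡⟨ cong (adj X (f x)) (sym (strictlyInverseˡ (perm σ) z)) ⟩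
    adj X (f x) (f (g z))  ≡⟨ preserve σ x (g z) ⟩
    adj X x (g z)          ≡⟨ x≈y (g z) ⟩
    adj X y (g z)          ≡⟨ sym (preserve σ y (g z)) ⟩
    adj X (f y) (f (g z))  ≡⟨ cong (adj X (f y)) (strictlyInverseˡ (perm σ) z) ⟩
    adj X (f y) z          ∎
    where
    open ≡-Reasoning
    f g : V X → V X
    f = apply σ
    g = from (perm σ)

module TwinQuotient (X : Graph) where

  open Representatives (twins-isDecEquivalence X) public

  quotient : Graph
  quotient = record
    { n      = #classes
    ; adj    = λ i j → adj X (ι i) (ι j)
    ; sym    = λ i j → Graph.sym X (ι i) (ι j)
    ; irrefl = λ i → Graph.irrefl X (ι i)
    }

  adj-[] : ∀ x y → adj quotient [ x ] [ y ] ≡ adj X x y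
  adj-[] x y = sym (twins-adj X (∼ι[] x) (∼ι[] y))

  quotient-worthy : Worthy quotient
  quotient-worthy i j same = trans (sym ([ι] i)) (trans ([]-resp ι-twins) ([ι] j))
    where
    ι-twins : Twins X (ι i) (ι j)
    ι-twins z = begin
      adj X (ι i) z          ≡⟨ twins-adj X (λ _ → refl) (∼ι[] z) ⟩
      adj quotient i [ z ]   ≡⟨ same [ z ] ⟩
      adj quotient j [ z ]   ≡⟨ sym (twins-adj X (λ _ → refl) (∼ι[] z)) ⟩
      adj X (ι j) z          ∎
      where open ≡-Reasoning

  walk-[] : ∀ {x y} → Walk X x y → Walk quotient [ x ] [ y ]
  walk-[] here                        = here
  walk-[] (step {x = x} {y = y} e w) = step (trans (adj-[] x y) e) (walk-[] w)

  quotient-connected : Connected X → Connected quotient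
  quotient-connected conn i j = subst₂ (Walk quotient) ([ι] i) ([ι] j) (walk-[] (conn (ι i) (ι j)))

  quotient-bipartition : Bipartition X → Bipartition quotient
  quotient-bipartition (c , proper) = c ∘ ι , λ i j → proper (ι i) (ι j)

  induced : Automorphism X → Fin #classes → Fin #classes
  induced σ i = [ apply σ (ι i) ]

  induced-[] : ∀ (σ : Automorphism X) x → induced σ [ x ] ≡ [ apply σ x ]
  induced-[] σ x = []-resp (automorphism-twins σ (λ z → sym (∼ι[] x z)))

  induced-inverse : ∀ (σ : Automorphism X) i → induced σ (induced (σ ⁻¹) i) ≡ i
  induced-inverse σ i =
    trans (induced-[] σ _) (trans (cong [_] (strictlyInverseˡ (perm σ) (ι i))) ([ι] i))

  induced-automorphism : Automorphism X → Automorphism quotient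
  induced-automorphism σ = record
    { perm     = mk↔ₛ′ (induced σ) (induced (σ ⁻¹)) (induced-inverse σ) (induced-inverse (σ ⁻¹))
    ; preserve = λ i j → trans (adj-[] (apply σ (ι i)) (apply σ (ι j))) (preserve σ (ι i) (ι j))
    }

  quotient-edgeTransitive : EdgeTransitive X → EdgeTransitive quotient
  quotient-edgeTransitive et i j u v e e′ with et (ι i) (ι j) (ι u) (ι v) e e′
  ... | σ , moves =
    induced-automorphism σ , subst₂ (λ u v → _ ≐ (u , v)) ([ι] u) ([ι] v) (≐-map [_] moves)

  classSize-automorphism : ∀ (σ : Automorphism X) x → classSize (apply σ x) ≡ classSize x
  classSize-automorphism σ =
    classSize-invariant (perm σ) (automorphism-twins σ) (automorphism-twins (σ ⁻¹))

  blowup : (b : Bipartition X) (k m : ℕ) →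
    (∀ x → classSize x ≡ (if proj₁ b x then m else k)) → IsoToBlowup X quotient (quotient-bipartition b) k m
  blowup b k m sizes = φ , adj-[]
    where
    Fin-cong : ∀ {a a′} → a ≡ a′ → Fin a ↔ Fin a′
    Fin-cong refl = ↔-refl
    φ : V X ↔ BlowupV quotient (quotient-bipartition b) k m
    φ = ↔-trans Fin↔Σ-classes (Σ-↔ ↔-refl (↔-trans (Sub↔Fin _) (Fin-cong (sizes (ι _)))))

module ColourClasses (X : Graph) (c : V X → Bool) (proper : ∀ x y → Edge X x y → c x ≢ c y)
  (et : EdgeTransitive X) (s : V X → ℕ) (s-invariant : ∀ (σ : Automorphism X) x → s (apply σ x) ≡ s x)
  where

  module FromEdge {u₀ w₀} (e₀ : Edge X u₀ w₀) where

    value : Bool → ℕ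
    value b = if does (b ≟ᵇ c u₀) then s u₀ else s w₀

    value-u₀ : value (c u₀) ≡ s u₀
    value-u₀ = cong (if_then s u₀ else s w₀) (dec-true (c u₀ ≟ᵇ c u₀) refl)

    value-w₀ : value (c w₀) ≡ s w₀
    value-w₀ = cong (if_then s u₀ else s w₀) (dec-false (c w₀ ≟ᵇ c u₀) (≢-sym (proper u₀ w₀ e₀)))

    edge-values : ∀ {a y} → Edge X a y → (s a , s y) ≐ (value (c a) , value (c y))
    edge-values {a} {y} e with et u₀ w₀ a y e₀ e
    ... | σ , moves = ≐-trans (≐-sym reference) (≐-map value (≢⇒≐ (proper u₀ w₀ e₀) (proper a y e)))
      where
      reference : (value (c u₀) , value (c w₀)) ≐ (s a , s y)
      reference = subst₂ (λ p q → (p , q) ≐ (s a , s y))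
        (trans (s-invariant σ u₀) (sym value-u₀)) (trans (s-invariant σ w₀) (sym value-w₀))
        (≐-map s moves)

    walk-values : ∀ {a x} → s a ≡ value (c a) → Walk X a x → s x ≡ value (c x)
    walk-values sa here       = sa
    walk-values sa (step e w) = walk-values (≐-cancelˡ sa (edge-values e)) w

  constant-on-colour : Connected X → ∀ {x x′} → c x ≡ c x′ → s x ≡ s x′
  constant-on-colour conn {x} {x′} same with conn x x′
  ... | here     = refl
  ... | step e w = begin
    s x            ≡⟨ sym value-u₀ ⟩
    value (c x)    ≡⟨ cong value same ⟩
    value (c x′)   ≡⟨ sym (walk-values (sym value-u₀) (step e w)) ⟩
    s x′           ∎
    where
    open ≡-Reasoning
    open FromEdge e

  colour-value : Connected X → (∀ x → 1 ≤ s x) → ∀ b → Σ ℕ λ t → 1 ≤ t × ∀ x → c x ≡ b → s x ≡ t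
  colour-value conn pos b with any? (λ x → c x ≟ᵇ b)
  ... | yes (x₀ , cx₀≡b) = s x₀ , pos x₀ , λ x cx≡b → constant-on-colour conn (trans cx≡b (sym cx₀≡b))
  -- an empty colour class may be given any size
  ... | no none          = 1 , s≤s z≤n , λ x cx≡b → ⊥-elim (none (x , cx≡b))

  by-colour : Connected X → (∀ x → 1 ≤ s x) →
    Σ ℕ λ k → Σ ℕ λ m → 1 ≤ k × 1 ≤ m × ∀ x → s x ≡ (if c x then m else k)
  by-colour conn pos with colour-value conn pos false | colour-value conn pos true
  ... | k , k-pos , s≡k | m , m-pos , s≡m = k , m , k-pos , m-pos , λ x → s≡ x (c x) refl
    where
    s≡ : ∀ x b → c x ≡ b → s x ≡ (if b then m else k)
    s≡ x false = s≡k x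
    s≡ x true  = s≡m x

lemma2p1 : (X : Graph) → Connected X → Bipartite X → EdgeTransitive X →
    Σ Graph λ Y → Σ (Bipartition Y) λ b → Σ ℕ λ k → Σ ℕ λ m →
    Connected Y × EdgeTransitive Y × Worthy Y × 1 ≤ k × 1 ≤ m ×
    IsoToBlowup X Y b k m
lemma2p1 X conn (c , proper) et =
  let k , m , k-pos , m-pos , sizes = by-colour conn classSize-pos in
  quotient , quotient-bipartition (c , proper) , k , m ,
  quotient-connected conn , quotient-edgeTransitive et , quotient-worthy , k-pos , m-pos ,
  blowup (c , proper) k m sizes
  where
  open TwinQuotient X
  open ColourClasses X c proper et classSize classSize-automorphism using (by-colour)
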